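{- Every YES-instance $(D,K,T)$ of \textsc{MD-SPP} or of \textsc{MD-RSPP} has a solution path cover whose union has at most $2^{|K|}+|K|$ vertices.
   Context: For a digraph $D=(V,E)$, $\mathcal{T}(D)$ is its transitive closure (edge $(i,j)$ iff $D$ has a directed $i$-$j$-path); for a directed path $P$, $\mathcal{T}(P)$ is the transitive closure of $P$. \textsc{MD-SPP}: input $(D,K,T)$ with $D$ a digraph, $T\in\mathbb{N}$, $K$ a set of routed commodities $(s,t,P)$ with $P$ a directed $s$-$t$-path in $D$; YES iff there is a subgraph $H\subseteq\mathcal{T}(D)$ of maximum outdegree at most $T$ with a directed $s$-$t$-path in $H\cap\mathcal{T}(P)$ for each $(s,t,P)\in K$. \textsc{MD-RSPP}: input $(D,K,T)$ with $K\subseteq V\times V$; YES iff there is a subgraph $H\subseteq\mathcal{T}(D)$ of maximum outdegree at most $T$ with a directed $s$-$t$-path in $H$ for each $(s,t)\in K$. Such an $H$ is a solution graph. A witness path of a commodity $(s,t,P)$ (for \textsc{MD-SPP}) is an $s$-$t$-path in $\mathcal{T}(P)$; a witness path of $(s,t)$ (for \textsc{MD-RSPP}) is an $s$-$t$-path in $\mathcal{T}(D)$. A solution path cover is a set of witness paths, one per commodity in $K$, whose union is a solution graph. -}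

module Defs where

open import Data.Nat using (ℕ; _≤_; _^_; _+_)
open import Data.Fin using (Fin)
open import Data.Fin.Properties using (_≟_)
open import Data.Fin.Subset as S using (Subset; ∣_∣)
open import Data.Vec using (tabulate)
open import Data.Bool using (Bool; true; false)
open import Data.List using (List; []; _∷_; concat; concatMap; length)
open import Data.List.Membership.Propositional as LM using ()
open import Data.List.Relation.Unary.All using (All)
open import Data.List.Relation.Unary.Any using (any?)
open import Data.List.Relation.Unary.Unique.Propositional using (Unique)
open import Data.List.Relation.Binary.Pointwise using (Pointwise)
open import Data.Product using (Σ; ∃; _×_; _,_)
open import Relation.Nullary using (¬_; does)
open import Relation.Binary.PropositionalEquality using (_≡_)

private variable n : ℕ

Graph : ℕ → Set
Graph n = Fin n → Subset n

Edge : Graph n → Fin n → Fin n → Set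
Edge G i j = j S.∈ G i

data Walk (E : Fin n → Fin n → Set) : Fin n → Fin n → List (Fin n) → Set where
  stop : ∀ {s} → Walk E s s (s ∷ [])
  step : ∀ {s u t xs} → E s u → Walk E u t (u ∷ xs) → Walk E s t (s ∷ u ∷ xs)

IsPath : (Fin n → Fin n → Set) → Fin n → Fin n → List (Fin n) → Set
IsPath E s t xs = Walk E s t xs × Unique xs

TC : Graph n → Fin n → Fin n → Set
TC D i j = ¬ (i ≡ j) × ∃ λ xs → IsPath (Edge D) i j xs

-- Transitive closure T(P) of a path P (vertex list): edge (i,j) iff i occurs
-- strictly before j on P.
data Before {n : ℕ} (i j : Fin n) : List (Fin n) → Set where
  here  : ∀ {xs} → j LM.∈ xs → Before i j (i ∷ xs)
  there : ∀ {x xs} → Before i j xs → Before i j (x ∷ xs)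

SubgraphOfTC : Graph n → Graph n → Set
SubgraphOfTC {n} H D = (i j : Fin n) → Edge H i j → TC D i j

MaxOutdeg≤ : Graph n → ℕ → Set
MaxOutdeg≤ {n} H T = (i : Fin n) → ∣ H i ∣ ≤ T

_∩_ : (Fin n → Fin n → Set) → (Fin n → Fin n → Set) → Fin n → Fin n → Set
(E ∩ F) i j = E i j × F i j

Commodity : ℕ → Set
Commodity n = Fin n × Fin n × List (Fin n)

ValidSPP : Graph n → List (Commodity n) → Set
ValidSPP D K = All (λ { (s , t , P) → IsPath (Edge D) s t P }) K

SolutionGraphSPP : Graph n → List (Commodity n) → ℕ → Graph n → Set
SolutionGraphSPP D K T H =
  SubgraphOfTC H D × MaxOutdeg≤ H T ×
  All (λ { (s , t , P) → ∃ λ W → IsPath (Edge H ∩ (λ i j → Before i j P)) s t W }) K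

YesSPP : Graph n → List (Commodity n) → ℕ → Set
YesSPP {n} D K T = ∃ λ (H : Graph n) → SolutionGraphSPP D K T H

WitnessSPP : Commodity n → List (Fin n) → Set
WitnessSPP (s , t , P) W = IsPath (λ i j → Before i j P) s t W

SolutionGraphRSPP : Graph n → List (Fin n × Fin n) → ℕ → Graph n → Set
SolutionGraphRSPP D K T H =
  SubgraphOfTC H D × MaxOutdeg≤ H T ×
  All (λ { (s , t) → ∃ λ W → IsPath (Edge H) s t W }) K

YesRSPP : Graph n → List (Fin n × Fin n) → ℕ → Set
YesRSPP {n} D K T = ∃ λ (H : Graph n) → SolutionGraphRSPP D K T H

WitnessRSPP : Graph n → Fin n × Fin n → List (Fin n) → Set
WitnessRSPP D (s , t) W = IsPath (TC D) s t W

pathEdges : List (Fin n) → List (Fin n × Fin n)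
pathEdges []           = []
pathEdges (x ∷ [])     = []
pathEdges (x ∷ y ∷ xs) = (x , y) ∷ pathEdges (y ∷ xs)

_≟ₑ_ : (e f : Fin n × Fin n) → Relation.Nullary.Dec (e ≡ f)
(a , b) ≟ₑ (c , d) = Data.Product.Properties.≡-dec _≟_ _≟_ (a , b) (c , d)
  where import Data.Product.Properties
        import Relation.Nullary

unionGraph : List (List (Fin n)) → Graph n
unionGraph ps i = tabulate λ j → does (any? ((i , j) ≟ₑ_) (concatMap pathEdges ps))

unionVertices : List (List (Fin n)) → Subset n
unionVertices ps = tabulate λ v → does (any? (v ≟_) (concat ps))

SolutionPathCoverSPP : Graph n → List (Commodity n) → ℕ → List (List (Fin n)) → Set
SolutionPathCoverSPP D K T ps =
  Pointwise WitnessSPP K ps × SolutionGraphSPP D K T (unionGraph ps)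

SolutionPathCoverRSPP : Graph n → List (Fin n × Fin n) → ℕ → List (List (Fin n)) → Set
SolutionPathCoverRSPP D K T ps =
  Pointwise (WitnessRSPP D) K ps × SolutionGraphRSPP D K T (unionGraph ps)

{-# OPTIONS --safe #-}
-- Start from the witness paths of a solution graph H, read as paths in T(P) ∩ T(D) (resp. T(D));
-- their union is a subgraph of H, so its outdegree is at most T. While the union has more than
-- 2^k + k vertices (k = |K|), the pigeonhole principle yields two vertices u ≠ v, neither of them
-- a target, that lie on exactly the same witness paths: there are at most k targets and only 2^k
-- membership profiles. Shortcut every path through u and v: whichever of the two comes first
-- jumps straight to the successor of the other. The allowed edge relations are transitive on
-- distinct vertices, so the results are again witness paths; afterwards u only has out-neighbours
-- that v had before and vice versa, while every other vertex keeps its own, so the outdegree bound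
-- survives; and the total length of the paths drops, so the process terminates.
module Submission where

open import Defs
open import Data.Bool using (Bool; true; false; if_then_else_)
open import Data.Empty using (⊥-elim)
open import Data.Fin using (Fin; zero; suc)
open import Data.Fin.Permutation.Components using (transpose)
open import Data.Fin.Properties using (_≟_; suc-injective; pigeonhole; <⇒≢)
open import Data.Fin.Subset as S using (Subset; ∣_∣; inside; outside)
open import Data.Fin.Subset.Properties using (p⊆q⇒∣p∣≤∣q∣)
open import Data.List using (List; []; _∷_; [_]; _++_; map; concat; concatMap; length; lookup)
open import Data.List.Properties using (length-map; length-++; ∷-injectiveˡ; ∷-injectiveʳ)
open import Data.List.Membership.Propositional using (_∈_; _∉_; find)
open import Data.List.Membership.Propositional.Properties
  using (∈-lookup; ∈-map⁺; ∈-map⁻; ∈-++⁺ˡ; ∈-++⁺ʳ; ∈-concat⁺′; ∈-concat⁻)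
open import Data.List.Relation.Binary.Pointwise as Pointwise using (Pointwise; []; _∷_; Pointwise-length)
open import Data.List.Relation.Binary.Subset.Propositional using (_⊆_)
open import Data.List.Relation.Binary.Subset.Propositional.Properties using (All-resp-⊇)
open import Data.List.Relation.Unary.All as All using (All; []; _∷_)
import Data.List.Relation.Unary.All.Properties as All
open import Data.List.Relation.Unary.Any as Any using (Any; here; there; any?)
import Data.List.Relation.Unary.Any.Properties as Any
open import Data.List.Relation.Unary.AllPairs using ([]; _∷_)
open import Data.List.Relation.Unary.Unique.Propositional using (Unique)
import Data.List.Relation.Unary.Unique.Propositional.Properties as Unique
open import Data.Nat using (ℕ; zero; suc; _≤_; _<_; _^_; _+_; z≤n; s≤s)
open import Data.Nat.Induction using (<-wellFounded)
open import Data.Nat.ListAction using (sum)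
open import Data.Nat.Properties
  using (≤-refl; ≤-trans; n≤1+n; m≤n⇒m≤1+n; +-comm; +-identityʳ; +-mono-≤; +-mono-<-≤; +-mono-≤-<;
         ≰⇒>; _≤?_)
open import Data.Product using (∃; ∃₂; _×_; _,_; proj₁; proj₂; map₂)
open import Data.Sum using (_⊎_; inj₁; inj₂)
open import Data.Sum.Properties using (inj₁-injective; inj₂-injective)
open import Data.Vec using ([]; _∷_; tabulate; here; there)
open import Data.Vec.Properties using (lookup∘tabulate; []=⇒lookup; lookup⇒[]=)
open import Function using (_∘_)
open import Induction.WellFounded using (Acc; acc)
open import Relation.Nullary using (Dec; yes; no; does)
open import Relation.Nullary.Decidable using (dec-true)
open import Relation.Unary using (Decidable)
open import Relation.Binary.PropositionalEquality
  using (_≡_; _≢_; refl; sym; trans; cong; cong₂; subst; subst₂; module ≡-Reasoning)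

private
  variable
    A B : Set
    n : ℕ
    E F R : Fin n → Fin n → Set
    a b s t u v w x y z : Fin n
    xs ys r : List (Fin n)

Unique⇒lookup-injective : ∀ {xs : List A} → Unique xs → ∀ {i j} → lookup xs i ≡ lookup xs j → i ≡ j
Unique⇒lookup-injective (_  ∷ _)    {zero}  {zero}  _  = refl
Unique⇒lookup-injective (x∉ ∷ _)    {zero}  {suc j} eq = ⊥-elim (All.lookup x∉ (∈-lookup j) eq)
Unique⇒lookup-injective (x∉ ∷ _)    {suc i} {zero}  eq = ⊥-elim (All.lookup x∉ (∈-lookup i) (sym eq))
Unique⇒lookup-injective (_  ∷ uniq) {suc i} {suc j} eq = cong suc (Unique⇒lookup-injective uniq eq)

Unique-pigeonhole : ∀ {xs : List A} {ys : List B} → Unique xs →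
                    (f : A → B) → (∀ {x} → x ∈ xs → f x ∈ ys) → length ys < length xs →
                    ∃₂ λ a b → a ∈ xs × b ∈ xs × a ≢ b × f a ≡ f b
Unique-pigeonhole {xs = xs} {ys} uniq f f∈ ys<xs
  with i , j , i<j , same ← pigeonhole ys<xs (Any.index ∘ f∈ ∘ ∈-lookup)
  = lookup xs i , lookup xs j , ∈-lookup i , ∈-lookup j
  , (<⇒≢ i<j ∘ Unique⇒lookup-injective uniq)
  , (begin
      f (lookup xs i)                           ≡⟨ Any.lookup-index (f∈ (∈-lookup i)) ⟩
      lookup ys (Any.index (f∈ (∈-lookup i))) ≡⟨ cong (lookup ys) same ⟩
      lookup ys (Any.index (f∈ (∈-lookup j))) ≡⟨ Any.lookup-index (f∈ (∈-lookup j)) ⟨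
      f (lookup xs j)                           ∎)
  where open ≡-Reasoning

does-≡⇒ : {P Q : Set} (p? : Dec P) (q? : Dec Q) → does p? ≡ does q? → P → Q
does-≡⇒ _       (yes q) _  _ = q
does-≡⇒ (yes _) (no _)  () _
does-≡⇒ (no ¬p) (no _)  _  p = ⊥-elim (¬p p)

∉-map⇒All≢ : ∀ {f : B → A} {bs} {a : A} → a ∉ map f bs → All ((a ≢_) ∘ f) bs
∉-map⇒All≢ {bs = bs} a∉ = All.¬Any⇒All¬ bs (a∉ ∘ Any.map⁺)

module _ {P : A → B → Set} where

  Pointwise-∈ʳ : ∀ {as bs b} → Pointwise P as bs → b ∈ bs → ∃ λ a → P a b
  Pointwise-∈ʳ (p ∷ _)  (here refl) = _ , p
  Pointwise-∈ʳ (_ ∷ ps) (there b∈)  = Pointwise-∈ʳ ps b∈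

  Pointwise⇒All-∈ : ∀ {as bs} → Pointwise P as bs → All (λ a → ∃ λ b → b ∈ bs × P a b) as
  Pointwise⇒All-∈ []       = []
  Pointwise⇒All-∈ (p ∷ ps) =
    (_ , here refl , p) ∷ All.map (λ (b , b∈ , q) → b , there b∈ , q) (Pointwise⇒All-∈ ps)

  All∃⇒Pointwise : ∀ {as} → All (λ a → ∃ (P a)) as → ∃ (Pointwise P as)
  All∃⇒Pointwise []             = [] , []
  All∃⇒Pointwise ((b , p) ∷ ps) with bs , qs ← All∃⇒Pointwise ps = b ∷ bs , p ∷ qs

allBoolLists : ℕ → List (List Bool)
allBoolLists zero    = [ [] ]
allBoolLists (suc k) = map (true ∷_) (allBoolLists k) ++ map (false ∷_) (allBoolLists k)

length-allBoolLists : ∀ k → length (allBoolLists k) ≡ 2 ^ k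
length-allBoolLists zero    = refl
length-allBoolLists (suc k) = begin
  length (map (true ∷_) bss ++ map (false ∷_) bss)         ≡⟨ length-++ (map (true ∷_) bss) ⟩
  length (map (true ∷_) bss) + length (map (false ∷_) bss) ≡⟨ cong₂ _+_ (length-map _ bss) (length-map _ bss) ⟩
  length bss + length bss                                   ≡⟨ cong₂ _+_ (length-allBoolLists k) (length-allBoolLists k) ⟩
  2 ^ k + 2 ^ k                                             ≡⟨ cong (2 ^ k +_) (+-identityʳ (2 ^ k)) ⟨
  2 ^ suc k                                                 ∎
  where open ≡-Reasoning
        bss = allBoolLists k

∈-allBoolLists : (bs : List Bool) → bs ∈ allBoolLists (length bs)
∈-allBoolLists []           = here refl
∈-allBoolLists (true  ∷ bs) = ∈-++⁺ˡ (∈-map⁺ (true ∷_) (∈-allBoolLists bs))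
∈-allBoolLists (false ∷ bs) =
  ∈-++⁺ʳ (map (true ∷_) (allBoolLists (length bs))) (∈-map⁺ (false ∷_) (∈-allBoolLists bs))

toList : Subset n → List (Fin n)
toList []            = []
toList (inside  ∷ p) = zero ∷ map suc (toList p)
toList (outside ∷ p) = map suc (toList p)

length-toList : (p : Subset n) → length (toList p) ≡ ∣ p ∣
length-toList []            = refl
length-toList (inside  ∷ p) = cong suc (trans (length-map suc (toList p)) (length-toList p))
length-toList (outside ∷ p) = trans (length-map suc (toList p)) (length-toList p)

∈-toList⁻ : (p : Subset n) → x ∈ toList p → x S.∈ p
∈-toList⁻ (inside  ∷ p) (here refl) = here
∈-toList⁻ (inside  ∷ p) (there x∈) with _ , y∈ , refl ← ∈-map⁻ suc x∈ = there (∈-toList⁻ p y∈)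
∈-toList⁻ (outside ∷ p) x∈         with _ , y∈ , refl ← ∈-map⁻ suc x∈ = there (∈-toList⁻ p y∈)

toList-Unique : (p : Subset n) → Unique (toList p)
toList-Unique []            = []
toList-Unique (inside  ∷ p) =
  All.map⁺ (All.universal (λ _ ()) (toList p)) ∷ Unique.map⁺ suc-injective (toList-Unique p)
toList-Unique (outside ∷ p) = Unique.map⁺ suc-injective (toList-Unique p)

module _ {P : Fin n → Set} (P? : Decidable P) where

  ∈-tabulate⁺ : P x → x S.∈ tabulate (does ∘ P?)
  ∈-tabulate⁺ {x = x} px = lookup⇒[]= x _ (trans (lookup∘tabulate (does ∘ P?) x) (dec-true (P? x) px))

  ∈-tabulate⁻ : x S.∈ tabulate (does ∘ P?) → P x
  ∈-tabulate⁻ {x = x} x∈ with P? x | trans (sym (lookup∘tabulate (does ∘ P?) x)) ([]=⇒lookup x∈)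
  ... | yes px | _ = px
  ... | no _   | ()

transpose-matchˡ : (i j : Fin n) → transpose i j i ≡ j
transpose-matchˡ i j with i ≟ i
... | yes _   = refl
... | no  i≢i = ⊥-elim (i≢i refl)

transpose-matchʳ : (i j : Fin n) → transpose i j j ≡ i
transpose-matchʳ i j with j ≟ i
... | yes j≡i = j≡i
... | no  _ with j ≟ j
...   | yes _   = refl
...   | no  j≢j = ⊥-elim (j≢j refl)

transpose-other : {i j k : Fin n} → k ≢ i → k ≢ j → transpose i j k ≡ k
transpose-other {i = i} {j} {k} k≢i k≢j with k ≟ i
... | yes k≡i = ⊥-elim (k≢i k≡i)
... | no  _ with k ≟ j
...   | yes k≡j = ⊥-elim (k≢j k≡j)
...   | no  _   = refl

-- Walks and paths

-- TC D is irreflexive, so it is only transitive between distinct endpoints.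
Transitive≢ : (Fin n → Fin n → Set) → Set
Transitive≢ R = ∀ {x y z} → R x y → R y z → x ≢ z → R x z

pathEdges-∈ˡ : (x , y) ∈ pathEdges xs → x ∈ xs
pathEdges-∈ˡ {xs = _ ∷ _ ∷ _}  (here refl) = here refl
pathEdges-∈ˡ {xs = _ ∷ _ ∷ ys} (there e)   = there (pathEdges-∈ˡ e)

pathEdges-∷⁺ : (a , b) ∈ pathEdges xs → (a , b) ∈ pathEdges (x ∷ xs)
pathEdges-∷⁺ {xs = _ ∷ _} e = there e

pathEdges-∷⁻ : (a , b) ∈ pathEdges (x ∷ ys) →
               (a ≡ x × (w , b) ∈ pathEdges (w ∷ ys)) ⊎ (a , b) ∈ pathEdges ys
pathEdges-∷⁻ {ys = _ ∷ _} (here refl) = inj₁ (refl , here refl)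
pathEdges-∷⁻ {ys = _ ∷ _} (there e)   = inj₂ e

Walk-map : (∀ {x y} → (x , y) ∈ pathEdges xs → E x y → F x y) → Walk E s t xs → Walk F s t xs
Walk-map f stop       = stop
Walk-map f (step e w) = step (f (here refl) e) (Walk-map (f ∘ there) w)

IsPath-map : (∀ {x y} → (x , y) ∈ pathEdges xs → E x y → F x y) → IsPath E s t xs → IsPath F s t xs
IsPath-map f (walk , uniq) = Walk-map f walk , uniq

Walk⇒edge : Walk E s t xs → (x , y) ∈ pathEdges xs → E x y
Walk⇒edge (step e _) (here refl) = e
Walk⇒edge (step _ w) (there p)   = Walk⇒edge w p

Walk-∷ : E s u → Walk E u t xs → Walk E s t (s ∷ xs)
Walk-∷ e stop        = step e stop
Walk-∷ e (step e′ w) = step e (step e′ w)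

Walk-++ : Walk E s u xs → Walk E u t ys → ∃ (Walk E s t)
Walk-++ stop        w₂ = _ , w₂
Walk-++ (step e w₁) w₂ with _ , w ← Walk-++ w₁ w₂ = _ , Walk-∷ e w

IsPath-suffix : Walk E u t xs → Unique xs → s ∈ xs → ∃ (IsPath E s t)
IsPath-suffix stop       uniq       (here refl) = _ , stop , uniq
IsPath-suffix (step e w) uniq       (here refl) = _ , step e w , uniq
IsPath-suffix (step _ w) (_ ∷ uniq) (there s∈)  = IsPath-suffix w uniq s∈

Walk⇒IsPath : Walk E s t xs → ∃ (IsPath E s t)
Walk⇒IsPath stop = _ , stop , [] ∷ []
Walk⇒IsPath {s = s} (step e w) with ys , path , uniq ← Walk⇒IsPath w with any? (s ≟_) ys
... | yes s∈ = IsPath-suffix path uniq s∈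
... | no  s∉ = s ∷ ys , Walk-∷ e path , All.¬Any⇒All¬ ys s∉ ∷ uniq

TC-trans : {D : Graph n} → Transitive≢ (TC D)
TC-trans (_ , _ , w₁ , _) (_ , _ , w₂ , _) x≢z = x≢z , Walk⇒IsPath (proj₂ (Walk-++ w₁ w₂))

Before-∈ : Before a b xs → b ∈ xs
Before-∈ (here b∈)   = there b∈
Before-∈ (there a<b) = there (Before-∈ a<b)

Before-trans : Unique xs → Before a b xs → Before b z xs → Before a z xs
Before-trans (a∉ ∷ _)   (here b∈)   (here _)    = ⊥-elim (All.lookup a∉ b∈ refl)
Before-trans _          (here _)    (there b<z) = here (Before-∈ b<z)
Before-trans (b∉ ∷ _)   (there a<b) (here _)    = ⊥-elim (All.lookup b∉ (Before-∈ a<b) refl)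
Before-trans (_ ∷ uniq) (there a<b) (there b<z) = there (Before-trans uniq a<b b<z)

unionGraph⁺ : {ps : List (List (Fin n))} → r ∈ ps → (x , y) ∈ pathEdges r → Edge (unionGraph ps) x y
unionGraph⁺ {x = x} {ps = ps} r∈ e =
  ∈-tabulate⁺ (λ j → any? ((x , j) ≟ₑ_) (concatMap pathEdges ps))
              (∈-concat⁺′ e (∈-map⁺ pathEdges r∈))

unionGraph⁻ : {ps : List (List (Fin n))} → Edge (unionGraph ps) x y → ∃ λ r → r ∈ ps × (x , y) ∈ pathEdges r
unionGraph⁻ {x = x} {ps = ps} e =
  find (Any.map⁻ (∈-concat⁻ (map pathEdges ps)
                             (∈-tabulate⁻ (λ j → any? ((x , j) ≟ₑ_) (concatMap pathEdges ps)) e)))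

unionVertices⁻ : {ps : List (List (Fin n))} → x S.∈ unionVertices ps → x ∈ concat ps
unionVertices⁻ {ps = ps} = ∈-tabulate⁻ (λ v → any? (v ≟_) (concat ps))

-- Shortcutting paths at a pair of twins

dropThrough : Fin n → List (Fin n) → List (Fin n)
dropThrough w []       = []
dropThrough w (x ∷ xs) = if does (x ≟ w) then xs else dropThrough w xs

dropThrough-⊆ : dropThrough w xs ⊆ xs
dropThrough-⊆ {w = w} {xs = x ∷ xs} a∈ with x ≟ w
... | yes _ = there a∈
... | no  _ = there (dropThrough-⊆ a∈)

dropThrough-Unique : Unique xs → Unique (dropThrough w xs)
dropThrough-Unique [] = []
dropThrough-Unique {xs = x ∷ xs} {w = w} (_ ∷ uniq) with x ≟ w
... | yes _ = uniq
... | no  _ = dropThrough-Unique uniq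

dropThrough-∉ : Unique xs → w ∉ dropThrough w xs
dropThrough-∉ {xs = x ∷ xs} {w = w} (x∉ ∷ uniq) with x ≟ w
... | yes refl = All.All¬⇒¬Any x∉
... | no  _    = dropThrough-∉ uniq

pathEdges-dropThrough : (a , b) ∈ pathEdges (w ∷ dropThrough w xs) → (a , b) ∈ pathEdges xs
pathEdges-dropThrough {w = w} {xs = x ∷ xs} e with x ≟ w
... | yes refl = e
... | no  _    = pathEdges-∷⁺ (pathEdges-dropThrough e)

pathEdges-∷-dropThrough : All (x ≢_) xs → Unique xs → (a , b) ∈ pathEdges (x ∷ dropThrough w xs) →
                          (a ≡ x × (w , b) ∈ pathEdges xs) ⊎ (a ≢ x × a ≢ w × (a , b) ∈ pathEdges xs)
pathEdges-∷-dropThrough {w = w} x∉ uniq e with pathEdges-∷⁻ {w = w} e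
... | inj₁ (refl , e′) = inj₁ (refl , pathEdges-dropThrough e′)
... | inj₂ e′          = inj₂ (a≢x , a≢w , pathEdges-dropThrough (pathEdges-∷⁺ e′))
  where
  a∈ = pathEdges-∈ˡ e′
  a≢x = λ a≡x → All.lookup x∉ (dropThrough-⊆ a∈) (sym a≡x)
  a≢w = λ { refl → dropThrough-∉ uniq a∈ }

length-dropThrough : ∀ w (xs : List (Fin n)) → length (dropThrough w xs) ≤ length xs
length-dropThrough w []       = z≤n
length-dropThrough w (x ∷ xs) with x ≟ w
... | yes _ = n≤1+n (length xs)
... | no  _ = m≤n⇒m≤1+n (length-dropThrough w xs)

length-dropThrough-< : w ∈ xs → length (dropThrough w xs) < length xs
length-dropThrough-< {w = w} {xs = x ∷ xs} w∈ with x ≟ w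
... | yes _   = ≤-refl
... | no  x≢w = m≤n⇒m≤1+n (length-dropThrough-< (Any.tail (x≢w ∘ sym) w∈))

Walk-dropThrough : Transitive≢ R → Walk R x t (x ∷ xs) → All (x ≢_) xs → Unique xs → w ∈ xs → w ≢ t →
                   Walk R x t (x ∷ dropThrough w xs)
Walk-dropThrough tr (step _ stop) _ _ (here refl) w≢t = ⊥-elim (w≢t refl)
Walk-dropThrough {w = w} tr (step {u = z} xRz (step zRy walk)) (_ ∷ x≢y ∷ x∉) (_ ∷ uniq) w∈ w≢t with z ≟ w
... | yes _   = step (tr xRz zRy x≢y) walk
... | no  z≢w =
  Walk-dropThrough tr (step (tr xRz zRy x≢y) walk) (x≢y ∷ x∉) uniq (Any.tail (z≢w ∘ sym) w∈) w≢t

IsPath-dropThrough : Transitive≢ R → IsPath R x t (x ∷ xs) → w ∈ xs → w ≢ t →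
                     IsPath R x t (x ∷ dropThrough w xs)
IsPath-dropThrough tr (walk , x∉ ∷ uniq) w∈ w≢t =
  Walk-dropThrough tr walk x∉ uniq w∈ w≢t , All-resp-⊇ dropThrough-⊆ x∉ ∷ dropThrough-Unique uniq

Twins : Fin n → Fin n → List (Fin n) → Set
Twins u v r = (u ∈ r → v ∈ r) × (v ∈ r → u ∈ r)

Twins-tail : x ≢ u → x ≢ v → Twins u v (x ∷ xs) → Twins u v xs
Twins-tail x≢u x≢v (u⇒v , v⇒u) =
  Any.tail (x≢v ∘ sym) ∘ u⇒v ∘ there , Any.tail (x≢u ∘ sym) ∘ v⇒u ∘ there

Twins-partnerʳ : u ≢ v → Twins u v (u ∷ xs) → v ∈ xs
Twins-partnerʳ u≢v (u⇒v , _) = Any.tail (u≢v ∘ sym) (u⇒v (here refl))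

Twins-partnerˡ : u ≢ v → Twins u v (v ∷ xs) → u ∈ xs
Twins-partnerˡ u≢v (_ , v⇒u) = Any.tail u≢v (v⇒u (here refl))

shortcut : Fin n → Fin n → List (Fin n) → List (Fin n)
shortcut u v []       = []
shortcut u v (x ∷ xs) =
  x ∷ (if does (x ≟ u) then dropThrough v xs else if does (x ≟ v) then dropThrough u xs else shortcut u v xs)

shortcut-⊆ : shortcut u v xs ⊆ xs
shortcut-⊆ {xs = x ∷ xs} (here refl) = here refl
shortcut-⊆ {u = u} {v} {xs = x ∷ xs} (there a∈) with x ≟ u | x ≟ v
... | yes _ | _     = there (dropThrough-⊆ a∈)
... | no  _ | yes _ = there (dropThrough-⊆ a∈)
... | no  _ | no  _ = there (shortcut-⊆ a∈)

IsPath-shortcut : Transitive≢ R → u ≢ v → u ≢ t → v ≢ t → Twins u v r →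
                  Walk R s t r → Unique r → IsPath R s t (shortcut u v r)
IsPath-shortcut {u = u} {v} {s = s} _ _ u≢t v≢t _ stop uniq with s ≟ u | s ≟ v
... | yes refl | _        = ⊥-elim (u≢t refl)
... | no  _    | yes refl = ⊥-elim (v≢t refl)
... | no  _    | no  _    = stop , uniq
IsPath-shortcut {u = u} {v} {s = s} tr u≢v u≢t v≢t tw (step e walk) (s∉ ∷ uniq) with s ≟ u | s ≟ v
... | yes refl | _        = IsPath-dropThrough tr (step e walk , s∉ ∷ uniq) (Twins-partnerʳ u≢v tw) v≢t
... | no  _    | yes refl = IsPath-dropThrough tr (step e walk , s∉ ∷ uniq) (Twins-partnerˡ u≢v tw) u≢t
... | no  s≢u  | no  s≢v  =
  let walk′ , uniq′ = IsPath-shortcut tr u≢v u≢t v≢t (Twins-tail s≢u s≢v tw) walk uniq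
  in Walk-∷ e walk′ , All-resp-⊇ shortcut-⊆ s∉ ∷ uniq′

pathEdges-∷-shortcut : (a , b) ∈ pathEdges (x ∷ shortcut u v xs) →
                       (a ≡ x × (x , b) ∈ pathEdges (x ∷ xs)) ⊎ (a , b) ∈ pathEdges (shortcut u v xs)
pathEdges-∷-shortcut {xs = _ ∷ _} (here refl) = inj₁ (refl , here refl)
pathEdges-∷-shortcut {xs = _ ∷ _} (there e)   = inj₂ e

pathEdges-shortcut : Unique r → (a , b) ∈ pathEdges (shortcut u v r) → (transpose u v a , b) ∈ pathEdges r
pathEdges-shortcut {r = x ∷ xs} {u = u} {v} (x∉ ∷ uniq) e with x ≟ u | x ≟ v
... | yes refl | _ with pathEdges-∷-dropThrough x∉ uniq e
...   | inj₁ (refl , e′)      rewrite transpose-matchˡ u v     = pathEdges-∷⁺ e′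
...   | inj₂ (a≢u , a≢v , e′) rewrite transpose-other a≢u a≢v = pathEdges-∷⁺ e′
pathEdges-shortcut {r = x ∷ xs} {u = u} {v} (x∉ ∷ uniq) e | no _ | yes refl with pathEdges-∷-dropThrough x∉ uniq e
...   | inj₁ (refl , e′)      rewrite transpose-matchʳ u v     = pathEdges-∷⁺ e′
...   | inj₂ (a≢v , a≢u , e′) rewrite transpose-other a≢u a≢v = pathEdges-∷⁺ e′
pathEdges-shortcut {r = x ∷ xs} {u = u} {v} (x∉ ∷ uniq) e | no x≢u | no x≢v with pathEdges-∷-shortcut e
...   | inj₁ (refl , e′) rewrite transpose-other x≢u x≢v = e′
...   | inj₂ e′                                          = pathEdges-∷⁺ (pathEdges-shortcut uniq e′)

length-shortcut : ∀ u v (xs : List (Fin n)) → length (shortcut u v xs) ≤ length xs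
length-shortcut u v []       = z≤n
length-shortcut u v (x ∷ xs) with x ≟ u | x ≟ v
... | yes _ | _     = s≤s (length-dropThrough v xs)
... | no  _ | yes _ = s≤s (length-dropThrough u xs)
... | no  _ | no  _ = s≤s (length-shortcut u v xs)

length-shortcut-< : u ≢ v → Twins u v xs → u ∈ xs → length (shortcut u v xs) < length xs
length-shortcut-< {u = u} {v} {xs = x ∷ xs} u≢v tw u∈ with x ≟ u | x ≟ v
... | yes refl | _        = s≤s (length-dropThrough-< (Twins-partnerʳ u≢v tw))
... | no  _    | yes refl = s≤s (length-dropThrough-< (Twins-partnerˡ u≢v tw))
... | no  x≢u  | no  x≢v  = s≤s (length-shortcut-< u≢v (Twins-tail x≢u x≢v tw) (Any.tail (x≢u ∘ sym) u∈))

size : List (List A) → ℕ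
size = sum ∘ map length

size-shortcut : ∀ u v (ps : List (List (Fin n))) → size (map (shortcut u v) ps) ≤ size ps
size-shortcut u v []       = z≤n
size-shortcut u v (r ∷ ps) = +-mono-≤ (length-shortcut u v r) (size-shortcut u v ps)

size-shortcut-< : {ps : List (List (Fin n))} → u ≢ v → All (Twins u v) ps → Any (u ∈_) ps →
                  size (map (shortcut u v) ps) < size ps
size-shortcut-< {u = u} {v} {ps = _ ∷ ps} u≢v (tw ∷ _) (here u∈) =
  +-mono-<-≤ (length-shortcut-< u≢v tw u∈) (size-shortcut u v ps)
size-shortcut-< {u = u} {v} {ps = r ∷ _} u≢v (_ ∷ tws) (there u∈) =
  +-mono-≤-< (length-shortcut u v r) (size-shortcut-< u≢v tws u∈)

unionGraph-shortcut : {ps : List (List (Fin n))} → All Unique ps →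
                      Edge (unionGraph (map (shortcut u v) ps)) x y → Edge (unionGraph ps) (transpose u v x) y
unionGraph-shortcut {u = u} {v} uniqs e
  with _ , r′∈ , e′ ← unionGraph⁻ e
  with r , r∈ , refl ← ∈-map⁻ (shortcut u v) r′∈
  = unionGraph⁺ r∈ (pathEdges-shortcut (All.lookup uniqs r∈) e′)

MaxOutdeg≤-shortcut : ∀ {ps : List (List (Fin n))} {T} → All Unique ps →
                      MaxOutdeg≤ (unionGraph ps) T → MaxOutdeg≤ (unionGraph (map (shortcut u v) ps)) T
MaxOutdeg≤-shortcut {u = u} {v} {ps} uniqs deg x =
  ≤-trans (p⊆q⇒∣p∣≤∣q∣ (unionGraph-shortcut {u = u} {v} {ps = ps} uniqs)) (deg (transpose u v x))

-- Finding twins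

profile : List (List (Fin n)) → Fin n → List Bool
profile ps x = map (λ r → does (any? (x ≟_) r)) ps

profile-≡⇒Twins : (ps : List (List (Fin n))) → profile ps u ≡ profile ps v → All (Twins u v) ps
profile-≡⇒Twins []       _    = []
profile-≡⇒Twins {u = u} {v} (r ∷ ps) same =
  (does-≡⇒ (any? (u ≟_) r) (any? (v ≟_) r) head , does-≡⇒ (any? (v ≟_) r) (any? (u ≟_) r) (sym head))
  ∷ profile-≡⇒Twins ps (∷-injectiveʳ same)
  where head = ∷-injectiveˡ same

module _ (ps : List (List (Fin n))) (tg : List (Fin n)) where

  -- Targets are told apart by name and all other vertices by their profile, so two distinct
  -- vertices with the same signature are non-target twins.
  signature : Fin n → Fin n ⊎ List Bool
  signature x = if does (any? (x ≟_) tg) then inj₁ x else inj₂ (profile ps x)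

  signatures : List (Fin n ⊎ List Bool)
  signatures = map inj₁ tg ++ map inj₂ (allBoolLists (length ps))

  signature-∈ : ∀ x → signature x ∈ signatures
  signature-∈ x with any? (x ≟_) tg
  ... | yes x∈ = ∈-++⁺ˡ (∈-map⁺ inj₁ x∈)
  ... | no  _  = ∈-++⁺ʳ (map inj₁ tg) (∈-map⁺ inj₂ profile∈)
    where profile∈ = subst (λ k → profile ps x ∈ allBoolLists k) (length-map _ ps) (∈-allBoolLists (profile ps x))

  length-signatures : length signatures ≡ 2 ^ length ps + length tg
  length-signatures = begin
    length (map inj₁ tg ++ map inj₂ bss)         ≡⟨ length-++ (map inj₁ tg) ⟩
    length (map inj₁ tg) + length (map inj₂ bss) ≡⟨ cong₂ _+_ (length-map inj₁ tg) (length-map inj₂ bss) ⟩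
    length tg + length bss                        ≡⟨ cong (length tg +_) (length-allBoolLists (length ps)) ⟩
    length tg + 2 ^ length ps                     ≡⟨ +-comm (length tg) _ ⟩
    2 ^ length ps + length tg                     ∎
    where open ≡-Reasoning
          bss = allBoolLists (length ps)

  signature-≡ : a ≢ b → signature a ≡ signature b → a ∉ tg × b ∉ tg × profile ps a ≡ profile ps b
  signature-≡ {a = a} {b} a≢b same with any? (a ≟_) tg | any? (b ≟_) tg
  ... | yes _ | yes _ = ⊥-elim (a≢b (inj₁-injective same))
  ... | no a∉ | no b∉ = a∉ , b∉ , inj₂-injective same

  large⇒twins : 2 ^ length ps + length tg < ∣ unionVertices ps ∣ →
                ∃₂ λ u v → u ≢ v × u ∉ tg × v ∉ tg × Any (u ∈_) ps × All (Twins u v) ps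
  large⇒twins large
    with a , b , a∈ , _ , a≢b , same ←
           Unique-pigeonhole (toList-Unique (unionVertices ps)) signature (λ {x} _ → signature-∈ x)
                             (subst₂ _<_ (sym length-signatures) (sym (length-toList (unionVertices ps))) large)
    with a∉ , b∉ , same-profile ← signature-≡ a≢b same
    = a , b , a≢b , a∉ , b∉ , ∈-concat⁻ ps (unionVertices⁻ {ps = ps} (∈-toList⁻ (unionVertices ps) a∈))
    , profile-≡⇒Twins ps same-profile

-- Shrinking a family of routes

module Routing {C : Set} (source target : C → Fin n) where

  Routes : (C → Fin n → Fin n → Set) → List C → List (List (Fin n)) → Set
  Routes R K ps = Pointwise (λ c r → IsPath (R c) (source c) (target c) r) K ps

  private
    variable
      K : List C
      ps : List (List (Fin n))
      Q S : C → Fin n → Fin n → Set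

  Routes-map : (∀ {c x y} → Q c x y → S c x y) → Routes Q K ps → Routes S K ps
  Routes-map f = Pointwise.map (IsPath-map (λ _ → f))

  unionGraph-Routes : Routes Q K ps → Edge (unionGraph ps) x y → ∃ λ c → Q c x y
  unionGraph-Routes routes e
    with r , r∈ , e′ ← unionGraph⁻ e
    with c , walk , _ ← Pointwise-∈ʳ routes r∈
    = c , Walk⇒edge walk e′

  Routes⇒IsPath-unionGraph : Routes Q K ps →
                             All (λ c → ∃ (IsPath (Edge (unionGraph ps) ∩ Q c) (source c) (target c))) K
  Routes⇒IsPath-unionGraph routes =
    All.map (λ (r , r∈ , path) → r , IsPath-map (λ e q → unionGraph⁺ r∈ e , q) path)
            (Pointwise⇒All-∈ routes)

  Routes-shortcut : u ≢ v → All (λ c → Transitive≢ (Q c)) K →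
                    All ((u ≢_) ∘ target) K → All ((v ≢_) ∘ target) K → All (Twins u v) ps →
                    Routes Q K ps → Routes Q K (map (shortcut u v) ps)
  Routes-shortcut u≢v [] [] [] [] [] = []
  Routes-shortcut u≢v (tr ∷ trs) (u≢t ∷ u≢ts) (v≢t ∷ v≢ts) (tw ∷ tws) ((walk , uniq) ∷ routes) =
    IsPath-shortcut tr u≢v u≢t v≢t tw walk uniq ∷ Routes-shortcut u≢v trs u≢ts v≢ts tws routes

  module _ (Q : C → Fin n → Fin n → Set) (K : List C) (T : ℕ) (trs : All (λ c → Transitive≢ (Q c)) K) where

    SmallRoutes : Set
    SmallRoutes = ∃ λ qs → Routes Q K qs × MaxOutdeg≤ (unionGraph qs) T ×
                           ∣ unionVertices qs ∣ ≤ 2 ^ length K + length K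

    shrink : ∀ ps → Acc _<_ (size ps) → Routes Q K ps → MaxOutdeg≤ (unionGraph ps) T → SmallRoutes
    shrink ps (acc smaller) routes deg with ∣ unionVertices ps ∣ ≤? 2 ^ length K + length K
    ... | yes small = ps , routes , deg , small
    ... | no  large
      with u , v , u≢v , u∉ , v∉ , u∈ , tws ←
             large⇒twins ps (map target K)
                         (subst₂ (λ k l → 2 ^ k + l < ∣ unionVertices ps ∣)
                                 (Pointwise-length routes) (sym (length-map target K)) (≰⇒> large))
      = shrink (map (shortcut u v) ps) (smaller (size-shortcut-< u≢v tws u∈))
               (Routes-shortcut u≢v trs (∉-map⇒All≢ u∉) (∉-map⇒All≢ v∉) tws routes)
               (MaxOutdeg≤-shortcut (All.tabulate (proj₂ ∘ proj₂ ∘ Pointwise-∈ʳ routes)) deg)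

    smallRoutes : {H : Graph n} → MaxOutdeg≤ H T →
                  All (λ c → ∃ (IsPath (Edge H ∩ Q c) (source c) (target c))) K → SmallRoutes
    smallRoutes degH solutions with ps , routes ← All∃⇒Pointwise solutions =
      shrink ps (<-wellFounded (size ps)) (Routes-map proj₂ routes)
             (λ x → ≤-trans (p⊆q⇒∣p∣≤∣q∣ (λ e → proj₁ (proj₂ (unionGraph-Routes routes e))))
                            (degH x))

Admissible : Graph n → Commodity n → Fin n → Fin n → Set
Admissible D (_ , _ , P) = (λ i j → Before i j P) ∩ TC D

ValidSPP⇒Admissible-trans : {D : Graph n} {K : List (Commodity n)} →
                            ValidSPP D K → All (λ c → Transitive≢ (Admissible D c)) K
ValidSPP⇒Admissible-trans =
  All.map λ (_ , uniq) (b₁ , t₁) (b₂ , t₂) x≢z → Before-trans uniq b₁ b₂ , TC-trans t₁ t₂ x≢z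

smallSolutionPathCoverSPP :
  (n : ℕ) (D : Graph n) (K : List (Commodity n)) (T : ℕ) → ValidSPP D K → Unique K → YesSPP D K T →
  ∃ λ (ps : List (List (Fin n))) →
    SolutionPathCoverSPP D K T ps × ∣ unionVertices ps ∣ ≤ 2 ^ length K + length K
smallSolutionPathCoverSPP n D K T valid _ (H , H⊆TD , degH , solutions) =
  let qs , routes , degQ , small =
        smallRoutes (Admissible D) K T (ValidSPP⇒Admissible-trans valid) degH
                    (All.map (map₂ (IsPath-map λ _ (e , b) → e , b , H⊆TD _ _ e)) solutions)
  in qs
   , ( Routes-map proj₁ routes
     , (λ _ _ e → proj₂ (proj₂ (unionGraph-Routes routes e)))
     , degQ
     , All.map (map₂ (IsPath-map λ _ (e , b , _) → e , b)) (Routes⇒IsPath-unionGraph routes))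
   , small
  where open Routing {C = Commodity n} proj₁ (proj₁ ∘ proj₂)

smallSolutionPathCoverRSPP :
  (n : ℕ) (D : Graph n) (K : List (Fin n × Fin n)) (T : ℕ) → Unique K → YesRSPP D K T →
  ∃ λ (ps : List (List (Fin n))) →
    SolutionPathCoverRSPP D K T ps × ∣ unionVertices ps ∣ ≤ 2 ^ length K + length K
smallSolutionPathCoverRSPP n D K T _ (H , H⊆TD , degH , solutions) =
  let qs , routes , degQ , small =
        smallRoutes (λ _ → TC D) K T (All.universal {P = λ _ → Transitive≢ (TC D)} (λ _ → TC-trans) K)
                    degH
                    (All.map (map₂ (IsPath-map λ _ e → e , H⊆TD _ _ e)) solutions)
  in qs
   , ( routes
     , (λ _ _ e → proj₂ (unionGraph-Routes routes e))
     , degQ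
     , All.map (map₂ (IsPath-map λ _ → proj₁)) (Routes⇒IsPath-unionGraph routes))
   , small
  where open Routing {C = Fin n × Fin n} proj₁ proj₂

-- Neither part uses that the commodities are distinct.
lemma4 : ((n : ℕ) (D : Graph n) (K : List (Commodity n)) (T : ℕ) →
           ValidSPP D K → Unique K → YesSPP D K T →
           ∃ λ (ps : List (List (Fin n))) →
             SolutionPathCoverSPP D K T ps × ∣ unionVertices ps ∣ ≤ 2 ^ length K + length K)
       × ((n : ℕ) (D : Graph n) (K : List (Fin n × Fin n)) (T : ℕ) →
           Unique K → YesRSPP D K T →
           ∃ λ (ps : List (List (Fin n))) →
             SolutionPathCoverRSPP D K T ps × ∣ unionVertices ps ∣ ≤ 2 ^ length K + length K)
lemma4 = smallSolutionPathCoverSPP , smallSolutionPathCoverRSPP
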